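{- For all integers $m\ge0$ and $x\ge1$ with $x>m$ (i.e. density $m/x<1$), one has $\widehat c_{m,x}=0$.
   Context: A Ferrers diagram (FD) in $\mathbb{Z}_{\ge0}^{x}$ is a finite set $\lambda\subset\mathbb{Z}_{\ge0}^x$ (elements called nodes) such that if $\mathbf a\in\lambda$ and $0\le \mathbf x\le\mathbf a$ componentwise then $\mathbf x\in\lambda$. Let $\mu_x=\{0,e_1,\dots,e_x\}$. For an FD $\lambda\supseteq\mu_x$ in $\mathbb{Z}_{\ge0}^x$, the skew FD $\sigma=\lambda\setminus\mu_x$ is strict if every coordinate index $i\in\{1,\dots,x\}$ is nonzero in some node of $\sigma$. The support of a node is the set of indices of its nonzero coordinates. For $x\ge1$, $m\ge0$, $\widehat c_{m,x}$ is the number of strict skew FDs $\sigma=\lambda\setminus\mu_x$ with $m$ nodes that contain no reducible component fitting in a box of size 2, meaning: there is no nonempty $S\subseteq\{1,\dots,x\}$ such that every node of $\sigma$ has support contained in $S$ or in its complement and every node of $\sigma$ with support contained in $S$ has all coordinates in $\{0,1\}$. -}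

module Defs where

open import Data.Nat using (ℕ; zero; suc; _≤_)
open import Data.Bool using (Bool; true; false; if_then_else_)
open import Data.Fin using (Fin)
open import Data.Fin.Properties using (_≟_)
open import Data.Fin.Subset using (Subset; ∁; Nonempty) renaming (_∈_ to _∈ₛ_)
open import Data.Vec using (Vec; lookup; tabulate; replicate)
open import Data.Vec.Relation.Binary.Pointwise.Inductive using (Pointwise)
open import Data.List using (List; _∷_; length; map)
open import Data.List.Membership.Propositional using (_∈_; _∉_)
open import Data.List.Relation.Unary.All using (All)
open import Data.List.Relation.Unary.Unique.Propositional using (Unique)
open import Data.List using (allFin)
open import Data.Product using (Σ; _×_; ∃-syntax)
open import Data.Sum using (_⊎_)
open import Relation.Binary.PropositionalEquality using (_≡_; _≢_)
open import Relation.Nullary using (¬_; does)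

Node : ℕ → Set
Node x = Vec ℕ x

_≤ₙ_ : ∀ {x} → Node x → Node x → Set
a ≤ₙ b = Pointwise _≤_ a b

unitVec : ∀ {x} → Fin x → Node x
unitVec i = tabulate (λ j → if does (i ≟ j) then 1 else 0)

μ : (x : ℕ) → List (Node x)
μ x = replicate x 0 ∷ map unitVec (allFin x)

-- A skew FD σ = λ \ μ_x (with λ ⊇ μ_x an FD), represented as a duplicate-free
-- list of nodes disjoint from μ_x such that λ = μ_x ∪ σ is a down-set.
record SkewFD (x : ℕ) (σ : List (Node x)) : Set where
  field
    unique   : Unique σ
    disjoint : All (λ a → a ∉ μ x) σ
    downset  : ∀ {a} → a ∈ σ → ∀ (b : Node x) → b ≤ₙ a → (b ∈ μ x) ⊎ (b ∈ σ)

SuppIn : ∀ {x} → Node x → Subset x → Set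
SuppIn a S = ∀ i → lookup a i ≢ 0 → i ∈ₛ S

Strict : ∀ {x} → List (Node x) → Set
Strict {x} σ = ∀ (i : Fin x) → ∃[ a ] (a ∈ σ × lookup a i ≢ 0)

ReducibleBox2 : ∀ {x} → List (Node x) → Subset x → Set
ReducibleBox2 σ S =
  Nonempty S ×
  (∀ {a} → a ∈ σ → SuppIn a S ⊎ SuppIn a (∁ S)) ×
  (∀ {a} → a ∈ σ → SuppIn a S → ∀ i → lookup a i ≤ 1)

-- σ is one of the objects counted by ĉ_{m,x}
Counted : (m x : ℕ) → List (Node x) → Set
Counted m x σ =
  SkewFD x σ × length σ ≡ m × Strict σ × (∀ (S : Subset x) → ¬ ReducibleBox2 σ S)

-- The nodes of σ of degree two form a multigraph on the coordinates {1,…,x}: e_i + e_j is an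
-- edge i — j and 2e_i a loop at i. Since μ_x ∪ σ is a down-set, the support of every node of σ
-- lies inside one connected component, and a node with a coordinate ≥ 2 at i puts a loop at i.
-- The graph has at most m < x edges, so some component is a tree; its vertex set S (loop-free,
-- a union of components) is a reducible component fitting in a box of size 2.
module Submission where

open import Defs
open import Data.Bool using (Bool; true; false; if_then_else_)
open import Data.Fin using (Fin; zero; suc)
open import Data.Fin.Properties using (_≟_; any?; suc-injective)
open import Data.Fin.Subset using (Subset; ∁) renaming (_∈_ to _∈ₛ_; _∉_ to _∉ₛ_)
open import Data.Fin.Subset.Properties using (x∉p⇒x∈∁p)
open import Data.List using (List; []; _∷_; _++_; length; map; mapMaybe)
open import Data.List.Properties using (length-++-sucʳ; length-map; length-mapMaybe)
open import Data.List.Membership.Propositional using (_∈_; _∉_; find)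
open import Data.List.Membership.Propositional.Properties using (∈-∃++; ∈-map⁻)
open import Data.List.Relation.Unary.All as All using (All; []; _∷_)
open import Data.List.Relation.Unary.All.Properties using (++⁺; ++⁻; map⁻)
open import Data.List.Relation.Unary.Any as Any using (Any; here; there)
open import Data.Maybe using (Maybe; just; nothing)
open import Data.Nat using (ℕ; zero; suc; _+_; _≤_; _<_; _≥_; _>_; _≤?_; z≤n; s≤s; s≤s⁻¹)
open import Data.Nat.Properties as ℕ
  using (≤-refl; ≤-trans; ≤-<-trans; m<n⇒m<1+n; m≤n+m; +-identityʳ; <⇒≱; ≰⇒>; n≢0⇒n>0; n>0⇒n≢0)
open import Data.Product as Product using (∃; _×_; _,_; proj₁; proj₂)
open import Data.Sum using (_⊎_; inj₁; inj₂)
open import Data.Vec using (lookup; tabulate)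
open import Data.Vec.Properties using (lookup∘tabulate; tabulate∘lookup; lookup-replicate; lookup⇒[]=; []=⇒lookup)
import Data.Vec.Relation.Binary.Pointwise.Inductive as Pointwise
open import Function using (_∘_)
open import Level using (Level)
open import Relation.Binary.PropositionalEquality using (_≡_; _≢_; refl; sym; trans; cong; cong₂; subst)
open import Relation.Nullary using (¬_; Dec; does; yes; no; ¬?; contradiction)

private
  variable
    a b p q : Level
    A : Set a
    B : Set b

any⊎all : {P : A → Set p} {Q : A → Set q} {xs : List A} →
          All (λ x → P x ⊎ Q x) xs → Any P xs ⊎ All Q xs
any⊎all [] = inj₂ []
any⊎all (inj₁ px ∷ _) = inj₁ (here px)
any⊎all (inj₂ qx ∷ pqs) with any⊎all pqs
... | inj₁ any = inj₁ (there any)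
... | inj₂ all = inj₂ (qx ∷ all)

length-mapMaybe-< : ∀ (f : A → Maybe B) {xs} → Any (λ x → f x ≡ nothing) xs →
                    length (mapMaybe f xs) < length xs
length-mapMaybe-< f {x ∷ xs} (here fx≡nothing) rewrite fx≡nothing = s≤s (length-mapMaybe f xs)
length-mapMaybe-< f {x ∷ xs} (there any) with f x
... | just _  = s≤s (length-mapMaybe-< f any)
... | nothing = m<n⇒m<1+n (length-mapMaybe-< f any)

∈-mapMaybe⁺ : ∀ (f : A → Maybe B) {xs x y} → x ∈ xs → f x ≡ just y → y ∈ mapMaybe f xs
∈-mapMaybe⁺ f {x ∷ xs} (here refl) fx≡y rewrite fx≡y = here refl
∈-mapMaybe⁺ f {x′ ∷ xs} (there x∈xs) fx≡y with f x′
... | just _  = there (∈-mapMaybe⁺ f x∈xs fx≡y)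
... | nothing = ∈-mapMaybe⁺ f x∈xs fx≡y

2≤⇒≢0 : ∀ {n} → 2 ≤ n → n ≢ 0
2≤⇒≢0 (s≤s _) ()

Edge : ℕ → Set
Edge n = Fin n × Fin n

mapEdge : ∀ {m n} → (Fin m → Fin n) → Edge m → Edge n
mapEdge h = Product.map h h

Respects : ∀ {n} → (Fin n → Bool) → Edge n → Set
Respects f (u , v) = f u ≡ f v × (u ≡ v → f u ≡ false)

Respects-swap : ∀ {n} {f : Fin n → Bool} {u v} → Respects f (u , v) → Respects f (v , u)
Respects-swap (same , loop) = sym same , λ { refl → loop refl }

Respects-pullback : ∀ {m n} (h : Fin m → Fin n) {f : Fin n → Bool} {e : Edge m} →
                    Respects f (mapEdge h e) → Respects (f ∘ h) e
Respects-pullback h {e = u , v} (same , loop) = same , loop ∘ cong h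

-- A nonempty union of connected components of the multigraph E containing no loop.
record LoopFreeComponents {n} (E : List (Edge n)) : Set where
  field
    part     : Fin n → Bool
    nonempty : ∃ λ v → part v ≡ true
    respects : All (Respects part) E

data Joins₀ {n} (j : Fin n) : Edge (suc n) → Set where
  outward : Joins₀ j (zero , suc j)
  inward  : Joins₀ j (suc j , zero)

data Loop₀ {n} : Edge (suc n) → Set where
  loop₀ : Loop₀ (zero , zero)

data Inner {n} : Edge (suc n) → Set where
  inner : ∀ u v → Inner (suc u , suc v)

classify : ∀ {n} (e : Edge (suc n)) → (∃ λ j → Joins₀ j e) ⊎ Loop₀ e ⊎ Inner e
classify (zero  , zero)  = inj₂ (inj₁ loop₀)
classify (zero  , suc j) = inj₁ (j , outward)
classify (suc j , zero)  = inj₁ (j , inward)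
classify (suc u , suc v) = inj₂ (inj₂ (inner u v))

merge₀ : ∀ {n} → Fin n → Fin (suc n) → Fin n
merge₀ j zero    = j
merge₀ j (suc k) = k

contract : ∀ {n} {j : Fin n} {e} → Joins₀ j e → ∀ ys zs →
           LoopFreeComponents (map (mapEdge (merge₀ j)) (ys ++ zs)) →
           LoopFreeComponents (ys ++ e ∷ zs)
contract {j = j} joins ys zs L = record
  { part     = part ∘ merge₀ j
  ; nonempty = suc (proj₁ nonempty) , proj₂ nonempty
  ; respects = ++⁺ (proj₁ pulled) (respects-joining joins ∷ proj₂ pulled)
  }
  where
  open LoopFreeComponents L
  pulled = ++⁻ ys (All.map (Respects-pullback (merge₀ j) {part}) (map⁻ respects))
  respects-joining : ∀ {e} → Joins₀ j e → Respects (part ∘ merge₀ j) e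
  respects-joining outward = refl , λ ()
  respects-joining inward  = refl , λ ()

dropVertex₀ : ∀ {n} → Edge (suc n) → Maybe (Edge n)
dropVertex₀ (suc u , suc v) = just (u , v)
dropVertex₀ _               = nothing

dropVertex₀-Loop₀ : ∀ {n} {e : Edge (suc n)} → Loop₀ e → dropVertex₀ e ≡ nothing
dropVertex₀-Loop₀ loop₀ = refl

unmark₀ : ∀ {n} → (Fin n → Bool) → Fin (suc n) → Bool
unmark₀ f zero    = false
unmark₀ f (suc k) = f k

Respects-unmark₀ : ∀ {n} {f : Fin n → Bool} {E} → All (λ e → Loop₀ e ⊎ Inner e) E →
                   All (Respects f) (mapMaybe dropVertex₀ E) → All (Respects (unmark₀ f)) E
Respects-unmark₀ [] [] = []
Respects-unmark₀ (inj₁ loop₀ ∷ local) rs = (refl , λ _ → refl) ∷ Respects-unmark₀ local rs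
Respects-unmark₀ (inj₂ (inner u v) ∷ local) ((same , loop) ∷ rs) =
  (same , loop ∘ suc-injective) ∷ Respects-unmark₀ local rs

delete₀ : ∀ {n} {E : List (Edge (suc n))} → All (λ e → Loop₀ e ⊎ Inner e) E →
          LoopFreeComponents (mapMaybe dropVertex₀ E) → LoopFreeComponents E
delete₀ local L = record
  { part     = unmark₀ part
  ; nonempty = suc (proj₁ nonempty) , proj₂ nonempty
  ; respects = Respects-unmark₀ local respects
  }
  where open LoopFreeComponents L

isolated₀ : ∀ {n} {E : List (Edge (suc n))} → All Inner E → LoopFreeComponents E
isolated₀ inners = record
  { part     = λ { zero → true ; (suc _) → false }
  ; nonempty = zero , refl
  ; respects = All.map (λ { (inner u v) → refl , λ _ → refl }) inners
  }

-- Look at vertex 0: contract an edge joining it to another vertex; otherwise delete it if it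
-- carries a loop; otherwise it is isolated and {0} will do.
sparse⇒loopFreeComponents : ∀ n (E : List (Edge n)) → length E < n → LoopFreeComponents E
sparse⇒loopFreeComponents (suc n) E |E|<1+n with any⊎all (All.universal classify E)
... | inj₁ joining with find joining
...   | e , e∈E , j , joins with ∈-∃++ e∈E
...     | ys , zs , refl = contract joins ys zs (sparse⇒loopFreeComponents n _ |E′|<n)
  where
  |E′|<n : length (map (mapEdge (merge₀ j)) (ys ++ zs)) < n
  |E′|<n = subst (_< n) (sym (length-map (mapEdge (merge₀ j)) (ys ++ zs)))
                 (s≤s⁻¹ (subst (_< suc n) (length-++-sucʳ ys e zs) |E|<1+n))
sparse⇒loopFreeComponents (suc n) E |E|<1+n | inj₂ local with any⊎all local
... | inj₁ loops  = delete₀ local (sparse⇒loopFreeComponents n _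
                      (≤-trans (length-mapMaybe-< dropVertex₀ (Any.map dropVertex₀-Loop₀ loops))
                               (s≤s⁻¹ |E|<1+n)))
... | inj₂ inners = isolated₀ inners

δ : ∀ {n} → Fin n → Fin n → ℕ
δ i k = if does (i ≟ k) then 1 else 0

δ-cases : ∀ {n} (i k : Fin n) → (i ≡ k × δ i k ≡ 1) ⊎ (i ≢ k × δ i k ≡ 0)
δ-cases i k with i ≟ k
... | yes i≡k = inj₁ (i≡k , refl)
... | no  i≢k = inj₂ (i≢k , refl)

δ-refl : ∀ {n} (i : Fin n) → δ i i ≡ 1
δ-refl i with δ-cases i i
... | inj₁ (_ , δ≡1)   = δ≡1
... | inj₂ (i≢i , _) = contradiction refl i≢i

δ≤1 : ∀ {n} (i k : Fin n) → δ i k ≤ 1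
δ≤1 i k with δ-cases i k
... | inj₁ (_ , δ≡1) rewrite δ≡1 = ≤-refl
... | inj₂ (_ , δ≡0) rewrite δ≡0 = z≤n

δ≢0⇒≡ : ∀ {n} {i k : Fin n} → δ i k ≢ 0 → i ≡ k
δ≢0⇒≡ {i = i} {k} δ≢0 with δ-cases i k
... | inj₁ (i≡k , _) = i≡k
... | inj₂ (_ , δ≡0) = contradiction δ≡0 δ≢0

lookup-unitVec : ∀ {n} (i k : Fin n) → lookup (unitVec i) k ≡ δ i k
lookup-unitVec i = lookup∘tabulate (δ i)

unitVec-support : ∀ {n} {k i : Fin n} → lookup (unitVec k) i ≢ 0 → k ≡ i
unitVec-support {k = k} {i} ≢0 = δ≢0⇒≡ (≢0 ∘ trans (lookup-unitVec k i))

pairNode : ∀ {n} → Fin n → Fin n → Node n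
pairNode i j = tabulate λ k → δ i k + δ j k

lookup-pairNode : ∀ {n} (i j k : Fin n) → lookup (pairNode i j) k ≡ δ i k + δ j k
lookup-pairNode i j = lookup∘tabulate λ k → δ i k + δ j k

pairNode-support : ∀ {n} {i j k : Fin n} → lookup (pairNode i j) k ≢ 0 → i ≡ k ⊎ j ≡ k
pairNode-support {i = i} {j} {k} ≢0 with δ-cases i k | δ-cases j k
... | inj₁ (i≡k , _)   | _                = inj₁ i≡k
... | inj₂ _           | inj₁ (j≡k , _)   = inj₂ j≡k
... | inj₂ (_ , δik≡0) | inj₂ (_ , δjk≡0) =
  contradiction (trans (lookup-pairNode i j k) (cong₂ _+_ δik≡0 δjk≡0)) ≢0

pairNode-2≤⇒≡ : ∀ {n} {i j k : Fin n} → 2 ≤ lookup (pairNode i j) k → i ≡ j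
pairNode-2≤⇒≡ {i = i} {j} {k} 2≤ rewrite lookup-pairNode i j k with δ-cases i k | δ-cases j k
... | inj₁ (refl , _) | inj₁ (refl , _) = refl
... | inj₂ (_ , δik≡0) | _ rewrite δik≡0 = contradiction 2≤ (<⇒≱ (s≤s (δ≤1 j k)))
... | inj₁ _ | inj₂ (_ , δjk≡0) rewrite δjk≡0 | +-identityʳ (δ i k) =
  contradiction 2≤ (<⇒≱ (s≤s (δ≤1 i k)))

AbovePair : ∀ {n} → Node n → Fin n → Fin n → Set
AbovePair a i j = lookup a i ≢ 0 × lookup a j ≢ 0 × (i ≡ j → 2 ≤ lookup a i)

pairNode-≤⇒AbovePair : ∀ {n} {a : Node n} {i j} → pairNode i j ≤ₙ a → AbovePair a i j
pairNode-≤⇒AbovePair {a = a} {i} {j} le =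
  n>0⇒n≢0 (≤-trans 1≤i (bound i)) , n>0⇒n≢0 (≤-trans 1≤j (bound j)) , loop
  where
  bound : ∀ k → δ i k + δ j k ≤ lookup a k
  bound k = subst (_≤ lookup a k) (lookup-pairNode i j k) (Pointwise.lookup le k)
  1≤i : 1 ≤ δ i i + δ j i
  1≤i rewrite δ-refl i = s≤s z≤n
  1≤j : 1 ≤ δ i j + δ j j
  1≤j rewrite δ-refl j = m≤n+m 1 (δ i j)
  loop : i ≡ j → 2 ≤ lookup a i
  loop refl = subst (_≤ lookup a i) (cong₂ _+_ (δ-refl i) (δ-refl i)) (bound i)

AbovePair⇒pairNode-≤ : ∀ {n} {a : Node n} {i j} → AbovePair a i j → pairNode i j ≤ₙ a
AbovePair⇒pairNode-≤ {a = a} {i} {j} (i≢0 , j≢0 , loop) =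
  subst (pairNode i j ≤ₙ_) (tabulate∘lookup a) (Pointwise.tabulate⁺ bound)
  where
  bound : ∀ k → δ i k + δ j k ≤ lookup a k
  bound k with δ-cases i k | δ-cases j k
  ... | inj₁ (refl , δ≡1) | inj₁ (refl , _)  rewrite δ≡1         = loop refl
  ... | inj₁ (refl , δ≡1) | inj₂ (_ , δ≡0)   rewrite δ≡1 | δ≡0   = n≢0⇒n>0 i≢0
  ... | inj₂ (_ , δ≡0)    | inj₁ (refl , δ≡1) rewrite δ≡1 | δ≡0  = n≢0⇒n>0 j≢0
  ... | inj₂ (_ , δ≡0)    | inj₂ (_ , δ≡0′) rewrite δ≡0 | δ≡0′   = z≤n

pairNode-≤⇒∉μ : ∀ {x} {c : Node x} {i j} → pairNode i j ≤ₙ c → c ∉ μ x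
pairNode-≤⇒∉μ {i = i} {j} le (here refl) =
  proj₁ (pairNode-≤⇒AbovePair {i = i} {j} le) (lookup-replicate i 0)
pairNode-≤⇒∉μ {i = i} {j} le (there c∈units) with ∈-map⁻ unitVec c∈units
... | k , _ , refl with pairNode-≤⇒AbovePair le
... | i≢0 , j≢0 , loop with unitVec-support {k = k} {i} i≢0 | unitVec-support {k = k} {j} j≢0
... | refl | refl = <⇒≱ (s≤s (subst (_≤ 1) (sym (lookup-unitVec k k)) (δ≤1 k k))) (loop refl)

pairNode-≤-pairNode : ∀ {n} {i j k l : Fin n} → pairNode k l ≤ₙ pairNode i j →
                      (k , l) ≡ (i , j) ⊎ (k , l) ≡ (j , i)
pairNode-≤-pairNode {i = i} {j} {k} {l} le with pairNode-≤⇒AbovePair le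
... | k≢0 , l≢0 , loop
    with pairNode-support {i = i} {j} {k} k≢0 | pairNode-support {i = i} {j} {l} l≢0
... | inj₁ refl | inj₂ refl = inj₁ refl
... | inj₂ refl | inj₁ refl = inj₂ refl
... | inj₁ refl | inj₁ refl with pairNode-2≤⇒≡ {i = i} {j} (loop refl)
...   | refl = inj₁ refl
pairNode-≤-pairNode {i = i} {j} le | k≢0 , l≢0 , loop | inj₂ refl | inj₂ refl
    with pairNode-2≤⇒≡ {i = i} {j} (loop refl)
...   | refl = inj₂ refl

_≤ₙ?_ : ∀ {n} (a b : Node n) → Dec (a ≤ₙ b)
_≤ₙ?_ = Pointwise.decidable _≤?_

-- Only the value on the nodes e_i + e_j matters; one edge per node keeps |edges σ| ≤ |σ|.
edgeOf : ∀ {n} → Node n → Maybe (Edge n)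
edgeOf a with any? (λ k → any? (λ l → pairNode k l ≤ₙ? a))
... | yes (k , l , _) = just (k , l)
... | no _            = nothing

edgeOf-pairNode : ∀ {n} (i j : Fin n) →
                  ∃ λ e → edgeOf (pairNode i j) ≡ just e × (e ≡ (i , j) ⊎ e ≡ (j , i))
edgeOf-pairNode i j with any? (λ k → any? (λ l → pairNode k l ≤ₙ? pairNode i j))
... | yes (k , l , le) = (k , l) , refl , pairNode-≤-pairNode le
... | no ¬le           = contradiction (i , j , Pointwise.refl ≤-refl) ¬le

edges : ∀ {n} → List (Node n) → List (Edge n)
edges = mapMaybe edgeOf

module _ {x} {σ : List (Node x)} (skew : SkewFD x σ) (L : LoopFreeComponents (edges σ)) where
  open SkewFD skew
  open LoopFreeComponents L

  AbovePair⇒pairNode∈σ : ∀ {a i j} → a ∈ σ → AbovePair a i j → pairNode i j ∈ σ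
  AbovePair⇒pairNode∈σ {a} {i} {j} a∈σ above
    with downset a∈σ (pairNode i j) (AbovePair⇒pairNode-≤ above)
  ... | inj₁ pair∈μ = contradiction pair∈μ (pairNode-≤⇒∉μ {i = i} {j} (Pointwise.refl ≤-refl))
  ... | inj₂ pair∈σ = pair∈σ

  Respects-AbovePair : ∀ {a i j} → a ∈ σ → AbovePair a i j → Respects part (i , j)
  Respects-AbovePair {i = i} {j} a∈σ above with edgeOf-pairNode i j
  ... | e , edge≡e , orientation
      with All.lookup respects (∈-mapMaybe⁺ edgeOf (AbovePair⇒pairNode∈σ a∈σ above) edge≡e)
         | orientation
  ... | respects-e | inj₁ refl = respects-e
  ... | respects-e | inj₂ refl = Respects-swap respects-e

  support-connected : ∀ {a i j} → a ∈ σ → lookup a i ≢ 0 → lookup a j ≢ 0 → part i ≡ part j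
  support-connected {i = i} {j} a∈σ i≢0 j≢0 with i ≟ j
  ... | yes refl = refl
  ... | no  i≢j  = proj₁ (Respects-AbovePair a∈σ (i≢0 , j≢0 , λ i≡j → contradiction i≡j i≢j))

  2≤⇒unmarked : ∀ {a i} → a ∈ σ → 2 ≤ lookup a i → part i ≡ false
  2≤⇒unmarked a∈σ 2≤ = proj₂ (Respects-AbovePair a∈σ (2≤⇒≢0 2≤ , 2≤⇒≢0 2≤ , λ _ → 2≤)) refl

  S : Subset x
  S = tabulate part

  marked⇒∈S : ∀ {i} → part i ≡ true → i ∈ₛ S
  marked⇒∈S {i} marked = lookup⇒[]= i S (trans (lookup∘tabulate part i) marked)

  unmarked⇒∉S : ∀ {i} → part i ≡ false → i ∉ₛ S
  unmarked⇒∉S {i} unmarked i∈S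
    with trans (sym unmarked) (trans (sym (lookup∘tabulate part i)) ([]=⇒lookup i∈S))
  ... | ()

  support-split : ∀ {a} → a ∈ σ → SuppIn a S ⊎ SuppIn a (∁ S)
  support-split {a} a∈σ with any? (λ i → ¬? (lookup a i ℕ.≟ 0))
  ... | no  zero-node  = inj₁ λ i i≢0 → contradiction (i , i≢0) zero-node
  ... | yes (i , i≢0) with part i in part-i
  ...   | true  = inj₁ λ j j≢0 → marked⇒∈S (trans (sym (support-connected a∈σ i≢0 j≢0)) part-i)
  ...   | false = inj₂ λ j j≢0 →
                    x∉p⇒x∈∁p (unmarked⇒∉S (trans (sym (support-connected a∈σ i≢0 j≢0)) part-i))

  inS⇒box2 : ∀ {a} → a ∈ σ → SuppIn a S → ∀ i → lookup a i ≤ 1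
  inS⇒box2 {a} a∈σ inS i with lookup a i ≤? 1
  ... | yes ≤1 = ≤1
  ... | no  ≰1 = contradiction (inS i (2≤⇒≢0 (≰⇒> ≰1))) (unmarked⇒∉S (2≤⇒unmarked a∈σ (≰⇒> ≰1)))

  reducible : ReducibleBox2 σ S
  reducible = (proj₁ nonempty , marked⇒∈S (proj₂ nonempty)) , support-split , inS⇒box2

proposition6 : ∀ (m x : ℕ) → x ≥ 1 → x > m →
    ∀ (σ : List (Node x)) → ¬ Counted m x σ
proposition6 m x _ m<x σ (skew , refl , _ , irreducible) = irreducible _ (reducible skew components)
  where
  components : LoopFreeComponents (edges σ)
  components = sparse⇒loopFreeComponents x (edges σ) (≤-<-trans (length-mapMaybe edgeOf σ) m<x)
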